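{- Let $u\le w$ in $\mathbb{P}^*$, order the maximal chains of $[u,w]$ lexicographically by their label sequences, and let $C: w=v_0\gtrdot v_1\gtrdot\cdots\gtrdot v_d=u$ be a maximal chain with labels $l(C)=(l_1,\dots,l_d)$. If $1\le j\le d-1$ and $l_j>l_{j+1}$ (i.e. $v_j$ is a descent of $C$), then the one-element interval $\{v_j\}=C(v_{j-1},v_{j+1})$ is a minimal skipped interval of $C$.
   Context: $\mathbb{P}^*$ is the set of finite words over the positive integers, with $u\le w$ iff $w$ has a subword $w(i_1)\cdots w(i_l)$ ($i_1<\dots<i_l$, $l=|u|$) with $u(j)\le w(i_j)$ for all $j$. Covers: $x$ covers $y$ iff $y$ is obtained from $x$ by decreasing one entry by $1$ (deleting it if it becomes $0$). An expansion of a word is a word over the nonnegative integers whose restriction to its nonzero positions equals that word. Labels: for a maximal chain $w=v_0\gtrdot\cdots\gtrdot v_d=u$ set $\eta_{v_0}=w$; for $j\ge1$, $\eta_{v_j}$ is the expansion of $v_j$ obtained from $\eta_{v_{j-1}}$ by subtracting $1$ from a single position $i$, where, if the entry goes from $1$ to $0$, $i$ is the position of the leftmost $1$ of the run (maximal block of consecutive equal letters) of $1$'s of $v_{j-1}$ containing the deleted entry; the label is $l_j=i$. Distinct maximal chains have distinct label sequences, and chains are ordered by lexicographic order of label sequences ($C'<C$ means $C'$ comes first). For $0\le i<j\le d$ with $j-i\ge2$, $C(v_i,v_j)=\{v_{i+1},\dots,v_{j-1}\}$. Such an interval $I$ is skipped if $C\setminus I\subseteq C'$ for some maximal chain $C'<C$,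 and a minimal skipped interval if it is skipped and strictly contains no other skipped interval of $C$. -}

module Defs where

open import Data.Nat using (ℕ; zero; suc; _≤_; _<_; _+_; _∸_)
open import Data.List using (List; []; _∷_; take; drop; length)
open import Data.List.Relation.Unary.All using (All)
open import Data.List.Membership.Propositional using (_∈_; _∉_)
open import Data.List.Relation.Binary.Lex.Strict using (Lex-<)
open import Data.Maybe using (Maybe; just; nothing)
open import Data.Product using (Σ; _×_; ∃)
open import Relation.Binary.PropositionalEquality using (_≡_; _≢_)
open import Relation.Nullary using (¬_)

-- Words over ℕ; elements of ℙ* are those with all entries positive.
Word : Set
Word = List ℕ

Pos : Word → Set
Pos = All (λ x → 0 < x)

data _≼_ : Word → Word → Set where
  nil  : [] ≼ []
  keep : ∀ {a b xs ys} → a ≤ b → xs ≼ ys → (a ∷ xs) ≼ (b ∷ ys)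
  skip : ∀ {b xs ys} → xs ≼ ys → xs ≼ (b ∷ ys)

data _⋗_ : Word → Word → Set where
  dec  : ∀ {a xs} → (suc (suc a) ∷ xs) ⋗ (suc a ∷ xs)
  del  : ∀ {xs} → (1 ∷ xs) ⋗ xs
  there : ∀ {x xs ys} → xs ⋗ ys → (x ∷ xs) ⋗ (x ∷ ys)

data MaxChain : Word → Word → List Word → Set where
  single : ∀ {u} → MaxChain u u (u ∷ [])
  step   : ∀ {w v u vs} → w ⋗ v → MaxChain v u vs → MaxChain w u (w ∷ vs)

-- restriction of an expansion to its nonzero positions
nz : List ℕ → List ℕ
nz [] = []
nz (zero ∷ xs) = nz xs
nz (suc a ∷ xs) = suc a ∷ nz xs

-- Dec1 i η η' : η' is η with the (positive) entry at position i decreased by 1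
-- (positions are 0-based).
data Dec1 : ℕ → List ℕ → List ℕ → Set where
  here  : ∀ {a xs} → Dec1 zero (suc a ∷ xs) (a ∷ xs)
  there : ∀ {i x xs ys} → Dec1 i xs ys → Dec1 (suc i) (x ∷ xs) (x ∷ ys)

-- entry at position i (0 if out of range)
at : List ℕ → ℕ → ℕ
at [] _ = 0
at (x ∷ xs) zero = x
at (x ∷ xs) (suc i) = at xs i

-- last nonzero entry of a list (0 if there is none)
lastNZ : List ℕ → ℕ
lastNZ [] = 0
lastNZ (zero ∷ xs) = lastNZ xs
lastNZ (suc a ∷ xs) with lastNZ xs
... | zero = suc a
... | suc b = suc b

-- If the entry at position i of η is 1 (so it becomes 0), then it is the
-- leftmost 1 of its run of 1's in nz η, i.e. the preceding nonzero entry
-- of η is not 1.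
LeftmostOK : ℕ → List ℕ → Set
LeftmostOK i η = at η i ≡ 1 → lastNZ (take i η) ≢ 1

-- LabelsFrom η C ls : with η the expansion of the head of C, the labels
-- of the remaining steps of C are ls.
data LabelsFrom : List ℕ → List Word → List ℕ → Set where
  end  : ∀ {η v} → LabelsFrom η (v ∷ []) []
  step : ∀ {η η' i v v' vs ls} →
         Dec1 i η η' → nz η' ≡ v' → LeftmostOK i η →
         LabelsFrom η' (v' ∷ vs) ls →
         LabelsFrom η (v ∷ v' ∷ vs) (i ∷ ls)

Labels : Word → List Word → List ℕ → Set
Labels w C ls = LabelsFrom w C ls

_<lex_ : List ℕ → List ℕ → Set
_<lex_ = Lex-< _≡_ _<_

-- C(vᵢ,v_k) = {v_{i+1},…,v_{k-1}}
Interval : List Word → ℕ → ℕ → List Word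
Interval C i k = take (k ∸ suc i) (drop (suc i) C)

ValidIdx : List Word → ℕ → ℕ → Set
ValidIdx C i k = (i + 2 ≤ k) × (k < length C)

_⊊_ : List Word → List Word → Set
I ⊊ J = (∀ {x} → x ∈ I → x ∈ J) × ∃ (λ x → x ∈ J × x ∉ I)

Skipped : Word → Word → List Word → List ℕ → ℕ → ℕ → Set
Skipped w u C ls i k =
  ValidIdx C i k ×
  Σ (List Word) (λ C' → Σ (List ℕ) (λ ls' →
    MaxChain w u C' × Labels w C' ls' × ls' <lex ls ×
    (∀ {x} → x ∈ C → x ∉ Interval C i k → x ∈ C')))

MinimalSkipped : Word → Word → List Word → List ℕ → ℕ → ℕ → Set
MinimalSkipped w u C ls i k =
  Skipped w u C ls i k ×
  (∀ i' k' → ValidIdx C i' k' → Interval C i' k' ⊊ Interval C i k →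
     ¬ Skipped w u C ls i' k')

_!_ : List ℕ → ℕ → Maybe ℕ
[] ! _ = nothing
(x ∷ xs) ! zero = just x
(x ∷ xs) ! suc i = xs ! i

-- At a descent l_j > l_{j+1} the two decrements act on distinct positions
-- l_{j+1} < l_j of the expansion, so they can be performed in the opposite
-- order.  This changes v_j alone, and the new chain has the same labels as C
-- before step j and the smaller label l_{j+1} at step j, so it precedes C and
-- {v_j} is skipped; the labels of the later steps may change, but they do not
-- affect the comparison.  The leftmost-1 condition of the new step j only looks
-- at entries left of l_{j+1}, which the decrement at l_j does not touch.
-- Minimality is automatic: every interval C(v_i, v_k) is nonempty, so none is
-- strictly contained in a one-element interval.
module Submission where

open import Defs
open import Data.Nat using (ℕ; zero; suc; _≤_; _<_; _∸_; z≤n; s≤s; _≟_)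
open import Data.Nat.Properties using (≤-reflexive; <⇒≤; +-comm; m+n∸n≡m)
open import Data.List using (List; []; _∷_; take; drop; length)
open import Data.List.Relation.Unary.All using (_∷_; [])
open import Data.List.Relation.Unary.Any using (here; there)
open import Data.List.Membership.Propositional using (_∈_; _∉_)
open import Data.List.Relation.Binary.Lex.Core using (this; next)
open import Data.Maybe using (just)
open import Data.Product using (Σ; _×_; _,_; ∃; map)
open import Data.Sum using (_⊎_; inj₁; inj₂; [_,_]′)
open import Data.Empty using (⊥-elim)
open import Relation.Nullary using (¬_; yes; no)
open import Relation.Nullary.Decidable using (_×-dec_)
open import Relation.Binary.PropositionalEquality using (_≡_; refl; sym; trans; cong; subst; _≢_)

nz-Pos : ∀ {w} → Pos w → nz w ≡ w
nz-Pos [] = refl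
nz-Pos (s≤s z≤n ∷ ps) = cong (_ ∷_) (nz-Pos ps)

lastNZ-∷-≢0 : ∀ a l → lastNZ (suc a ∷ l) ≢ 0
lastNZ-∷-≢0 a l with lastNZ l
... | zero = λ ()
... | suc _ = λ ()

lastNZ-∷≡1 : ∀ a l → lastNZ (suc a ∷ l) ≡ 1 → lastNZ l ≡ 1 ⊎ (a ≡ 0 × lastNZ l ≡ 0)
lastNZ-∷≡1 a l with lastNZ l
... | zero = λ { refl → inj₂ (refl , refl) }
... | suc _ = inj₁

Dec1⇒⋗ : ∀ {i η η'} → Dec1 i η η' → nz η ⋗ nz η'
Dec1⇒⋗ (here {zero}) = del
Dec1⇒⋗ (here {suc _}) = dec
Dec1⇒⋗ (there {x = zero} d) = Dec1⇒⋗ d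
Dec1⇒⋗ (there {x = suc _} d) = there (Dec1⇒⋗ d)

Dec1-swap : ∀ {a b η η₁ η₂} → b < a → Dec1 a η η₁ → Dec1 b η₁ η₂ →
            ∃ λ η' → Dec1 b η η' × Dec1 a η' η₂
Dec1-swap _ (there d) here = _ , here , there d
Dec1-swap (s≤s b<a) (there d) (there d') with Dec1-swap b<a d d'
... | _ , d₁ , d₂ = _ , there d₁ , there d₂

at-Dec1 : ∀ {a b η η₁} → Dec1 a η η₁ → b < a → at η b ≡ at η₁ b
at-Dec1 (there _) (s≤s z≤n) = refl
at-Dec1 {b = suc _} (there d) (s≤s b<a) = at-Dec1 d b<a

take-Dec1 : ∀ {a b η η₁} → Dec1 a η η₁ → b ≤ a → take b η ≡ take b η₁
take-Dec1 {b = zero} _ _ = refl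
take-Dec1 {b = suc _} (there d) (s≤s b≤a) = cong (_ ∷_) (take-Dec1 d b≤a)

LeftmostOK-Dec1⁻ : ∀ {a b η η₁} → Dec1 a η η₁ → b < a → LeftmostOK b η₁ → LeftmostOK b η
LeftmostOK-Dec1⁻ d b<a ok at≡1 =
  subst (λ l → lastNZ l ≢ 1) (sym (take-Dec1 d (<⇒≤ b<a))) (ok (trans (sym (at-Dec1 d b<a)) at≡1))

nz-delete-leading-1 : ∀ {i η η'} → Dec1 i η η' → at η i ≡ 1 → lastNZ (take i η) ≡ 0 →
                      nz η ≡ 1 ∷ nz η'
nz-delete-leading-1 (here {zero}) refl _ = refl
nz-delete-leading-1 (there {x = zero} d) at≡1 none = nz-delete-leading-1 d at≡1 none
nz-delete-leading-1 {suc i} (there {x = suc a} {xs = η} _) _ none =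
  ⊥-elim (lastNZ-∷-≢0 a (take i η) none)

record LabelledStep (η : List ℕ) (v : Word) : Set where
  constructor labelled
  field
    {label}   : ℕ
    {η'}      : List ℕ
    decrement : Dec1 label η η'
    restricts : nz η' ≡ v
    leftmost  : LeftmostOK label η

labelledStep : ∀ η {v} → nz η ⋗ v → LabelledStep η v
labelledStep (zero ∷ η) p with labelledStep η p
... | labelled d e ok = labelled (there d) e ok
labelledStep (suc (suc _) ∷ _) dec = labelled here refl λ ()
labelledStep (suc zero ∷ _) del = labelled here refl λ _ ()
labelledStep (suc c ∷ η) (there p) with labelledStep η p
... | labelled {i} d refl ok with c ≟ 0 ×-dec at η i ≟ 1 ×-dec lastNZ (take i η) ≟ 0
-- the deleted 1 extends the run of 1's starting at this entry, so the label is 0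
...   | yes (refl , at≡1 , none) = labelled here (nz-delete-leading-1 d at≡1 none) λ _ ()
...   | no ¬sameRun = labelled (there d) refl λ at≡1 last≡1 →
          [ ok at≡1 , (λ { (c≡0 , none) → ¬sameRun (c≡0 , at≡1 , none) }) ]′
            (lastNZ-∷≡1 c (take i η) last≡1)

LabelsFrom-∷ : ∀ {i η η' u C ls} → Dec1 i η η' → LeftmostOK i η →
               MaxChain (nz η') u C → LabelsFrom η' C ls → LabelsFrom η (nz η ∷ C) (i ∷ ls)
LabelsFrom-∷ d ok single L = step d refl ok L
LabelsFrom-∷ d ok (step _ _) L = step d refl ok L

labels : ∀ η {u vs} → MaxChain (nz η) u vs → ∃ (LabelsFrom η vs)
labels η single = [] , end
labels η (step p rest) with labelledStep η p
... | labelled d refl ok = map (_ ∷_) (LabelsFrom-∷ d ok rest) (labels _ rest)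

MaxChain-head : ∀ {v u x xs} → MaxChain v u (x ∷ xs) → MaxChain x u (x ∷ xs)
MaxChain-head single = single
MaxChain-head (step p rest) = step p rest

-- The second component of Skipped, with the labels read from an arbitrary
-- expansion η of the top of the chain.
Skippable : List ℕ → Word → Word → List Word → List ℕ → List Word → Set
Skippable η w u C ls I = Σ (List Word) λ C' → Σ (List ℕ) λ ls' →
  MaxChain w u C' × LabelsFrom η C' ls' × ls' <lex ls × (∀ {x} → x ∈ C → x ∉ I → x ∈ C')

descent-skippable : ∀ j {η w u C ls a b} → nz η ≡ w → MaxChain w u C → LabelsFrom η C ls →
                    ls ! j ≡ just a → ls ! suc j ≡ just b → b < a →
                    Skippable η w u C ls (Interval C j (suc (suc j)))
descent-skippable zero refl (step _ (step _ rest)) (step d₁ refl _ (step d₂ refl ok₂ _))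
                  refl refl b<a with Dec1-swap b<a d₁ d₂
... | _ , d₁' , d₂' with labels _ (step (Dec1⇒⋗ d₂') (MaxChain-head rest))
... | _ , L' =
  _ , _ , step (Dec1⇒⋗ d₁') (step (Dec1⇒⋗ d₂') (MaxChain-head rest)) ,
  step d₁' refl (LeftmostOK-Dec1⁻ d₁ b<a ok₂) L' , this b<a ,
  λ { (here refl) _ → here refl
    ; (there (here refl)) v₁∉I → ⊥-elim (v₁∉I (here refl))
    ; (there (there x∈C)) _ → there (there x∈C) }
descent-skippable (suc j) refl (step _ rest) (step d refl ok L) ea eb b<a
  with descent-skippable j refl (MaxChain-head rest) L ea eb b<a
... | _ , _ , chain , L' , ls'<ls , ⊆C' =
  _ , _ , step (Dec1⇒⋗ d) chain , LabelsFrom-∷ d ok chain L' , next refl ls'<ls ,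
  λ { (here refl) _ → here refl ; (there x∈C) x∉I → there (⊆C' x∈C x∉I) }

LabelsFrom-length : ∀ {η C ls} → LabelsFrom η C ls → length C ≡ suc (length ls)
LabelsFrom-length end = refl
LabelsFrom-length (step _ _ _ L) = cong suc (LabelsFrom-length L)

!≡just⇒<length : ∀ (ls : List ℕ) i {b} → ls ! i ≡ just b → i < length ls
!≡just⇒<length (_ ∷ _) zero _ = s≤s z≤n
!≡just⇒<length (_ ∷ ls) (suc i) e = s≤s (!≡just⇒<length ls i e)

Interval-nonempty : ∀ C {i k} → ValidIdx C i k → ∃ (_∈ Interval C i k)
Interval-nonempty (_ ∷ c ∷ _) {zero} {suc (suc _)} _ = c , here refl
Interval-nonempty (_ ∷ _ ∷ _) {zero} {suc zero} (s≤s () , _)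
Interval-nonempty (_ ∷ []) {zero} (s≤s (s≤s _) , s≤s ())
Interval-nonempty (_ ∷ C) {suc i} {suc k} (s≤s i+2≤k , s≤s k<len) = Interval-nonempty C (i+2≤k , k<len)

Interval-singleton : ∀ C j → Interval C j (suc (suc j)) ≡ take 1 (drop (suc j) C)
Interval-singleton C j = cong (λ n → take n (drop (suc j) C)) (m+n∸n≡m 1 j)

⊊-take-1 : ∀ (L : List Word) {I x} → I ⊊ take 1 L → x ∉ I
⊊-take-1 (_ ∷ _) (I⊆ , _ , here refl , y∉I) x∈I with I⊆ x∈I
... | here refl = y∉I x∈I

lemma4p3 : ∀ (u w : Word) → Pos u → Pos w → u ≼ w →
           ∀ (C : List Word) (ls : List ℕ) → MaxChain w u C → Labels w C ls →
           ∀ (j a b : ℕ) → 1 ≤ j → ls ! (j ∸ 1) ≡ just a → ls ! j ≡ just b → b < a →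
           MinimalSkipped w u C ls (j ∸ 1) (suc j)
lemma4p3 u w _ pw _ C ls chain L (suc j) _ _ _ ea eb b<a =
  (valid , descent-skippable j (nz-Pos pw) chain L ea eb b<a) , minimal
  where
  valid : ValidIdx C j (suc (suc j))
  valid = ≤-reflexive (+-comm j 2)
        , subst (suc (suc j) <_) (sym (LabelsFrom-length L)) (s≤s (!≡just⇒<length ls (suc j) eb))
  minimal : ∀ i k → ValidIdx C i k → Interval C i k ⊊ Interval C j (suc (suc j)) →
            ¬ Skipped w u C ls i k
  minimal i k ik I⊊ _ with Interval-nonempty C ik
  ... | _ , x∈I = ⊊-take-1 (drop (suc j) C) (subst (_ ⊊_) (Interval-singleton C j) I⊊) x∈I
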